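{- Let $m>2$ be an even integer, $q=2^m$, let $\epsilon\in\mathbb{F}_2$, and for $\beta\in\mathbb{F}_4^*$ let $$S_\beta(\epsilon)=\{b\in\mathbb{F}_q^*\mid \mathrm{Tr}(b^3)=\epsilon,\ \mathrm{Tr}_2(b)=\beta\}.$$ Then the set $\{b^3\mid b\in\bigcup_{\beta\in\mathbb{F}_4^*}S_\beta(\epsilon)\}$ (all of whose elements $a$ have the same residue of $K(a)$ modulo $24$) has exactly $$\frac13\sum_{\beta\in\mathbb{F}_4^*}\#S_\beta(\epsilon)$$ elements.
   Context: $\mathbb{F}_q$ is the finite field with $q=2^m$ elements, which contains $\mathbb{F}_4$ since $m$ is even; $\mathbb{F}_q^*=\mathbb{F}_q\setminus\{0\}$. $\mathrm{Tr}:\mathbb{F}_q\to\mathbb{F}_2$ is the absolute trace and $\mathrm{Tr}_2:\mathbb{F}_q\to\mathbb{F}_4$ is the relative trace $\mathrm{Tr}_2(x)=x+x^4+\dots+x^{4^{m/2-1}}$. $\chi(x)=(-1)^{\mathrm{Tr}(x)}$ and $K(a)=\sum_{x\in\mathbb{F}_q^*}\chi(x+ax^{ -1})$. -}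

module Defs where

open import Level using (0ℓ)
open import Data.Nat as ℕ using (ℕ; zero; suc)
open import Data.Bool using (Bool; true; false)
open import Data.List using (List; length; filter; map; deduplicate)
open import Data.List.Membership.Propositional using (_∈_)
open import Data.List.Relation.Unary.Unique.Propositional using (Unique)
open import Data.List.Relation.Unary.Any using (Any; any?)
open import Data.Product using (_×_; _,_)
open import Relation.Nullary using (¬_; Dec; yes; no)
open import Relation.Nullary.Decidable using (_×-dec_; ¬?)
open import Relation.Binary.PropositionalEquality using (_≡_)
open import Algebra.Structures using (IsCommutativeRing)

record GF2^ (m : ℕ) : Set₁ where
  field
    F    : Set
    _+_  : F → F → F
    _*_  : F → F → F
    -_   : F → F
    0#   : F
    1#   : F
    isCommutativeRing : IsCommutativeRing _≡_ _+_ _*_ -_ 0# 1#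
    _⁻¹  : F → F
    inverseʳ : ∀ x → ¬ (x ≡ 0#) → x * (x ⁻¹) ≡ 1#
    1≢0  : ¬ (1# ≡ 0#)
    char2 : 1# + 1# ≡ 0#
    _≟_  : (x y : F) → Dec (x ≡ y)
    elems : List F
    complete : ∀ x → x ∈ elems
    unique : Unique elems
    card : length elems ≡ 2 ℕ.^ m

  infixl 6 _+_
  infixl 7 _*_
  infixr 8 _^_

  _^_ : F → ℕ → F
  x ^ zero  = 1#
  x ^ suc n = x * (x ^ n)

  ∑ : ℕ → (ℕ → F) → F
  ∑ zero    f = 0#
  ∑ (suc n) f = ∑ n f + f n

  Tr : F → F
  Tr x = ∑ m (λ i → x ^ (2 ℕ.^ i))

  Tr₂ : F → F
  Tr₂ x = ∑ (m ℕ./ 2) (λ i → x ^ (4 ℕ.^ i))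

  ι : Bool → F
  ι false = 0#
  ι true  = 1#

  -- β ∈ F_4^*  (F_4 = {x | x^4 = x} ⊆ F)
  InF4* : F → Set
  InF4* β = (β ^ 4 ≡ β) × ¬ (β ≡ 0#)

  InF4*? : ∀ β → Dec (InF4* β)
  InF4*? β = ((β ^ 4) ≟ β) ×-dec ¬? (β ≟ 0#)

  F4* : List F
  F4* = filter InF4*? elems

  InS : F → Bool → F → Set
  InS β ε b = ¬ (b ≡ 0#) × (Tr (b ^ 3) ≡ ι ε) × (Tr₂ b ≡ β)

  InS? : ∀ β ε b → Dec (InS β ε b)
  InS? β ε b = ¬? (b ≟ 0#) ×-dec (Tr (b ^ 3) ≟ ι ε) ×-dec (Tr₂ b ≟ β)

  S : F → Bool → List F
  S β ε = filter (InS? β ε) elems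

  InUnion? : ∀ ε b → Dec (Any (λ β → InS β ε b) F4*)
  InUnion? ε b = any? (λ β → InS? β ε b) F4*

  Union : Bool → List F
  Union ε = filter (InUnion? ε) elems

  Cubes : Bool → List F
  Cubes ε = deduplicate _≟_ (map (λ b → b ^ 3) (Union ε))

-- Since m is even, F contains a primitive cube root of unity ω (in characteristic 2, ω² + ω = 1):
-- otherwise σ(x) = 1/(1 + x) would permute F ∖ {0, 1} with order 3 and no fixed points, forcing
-- 3 ∣ 2^m − 2, whereas 2^m ≡ 1 (mod 3). Because ω³ = 1 and ω⁴ = ω, multiplication by ω maps
-- S_β(ε) into S_{ωβ}(ε), so the union of the S_β(ε) is stable under it and b ↦ b³ is exactly
-- three-to-one on the union, with fibres {b, ωb, ω²b}. The S_β(ε) are disjoint since Tr₂ b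
-- determines β, so the sum of their sizes is the size of the union, three times the number of cubes.

module Submission where

open import Defs
open import Level using (0ℓ)
open import Algebra.Bundles using (CommutativeSemiring)
open import Algebra.Structures using (IsCommutativeRing)
open import Data.Bool using (Bool; if_then_else_)
open import Data.Empty using (⊥-elim)
open import Data.List using (List; []; _∷_; length; map; filter)
open import Data.List.Membership.Propositional using (_∈_; find; lose)
open import Data.List.Membership.Propositional.Properties
  using (∈-filter⁺; ∈-filter⁻; ∈-map⁺; ∈-map⁻; ∈-deduplicate⁺; ∈-deduplicate⁻)
import Data.List.Membership.DecPropositional as DecMembership
open import Data.List.Relation.Binary.Subset.Propositional using (_⊆_)
open import Data.List.Relation.Unary.All as All using ([]; _∷_)
open import Data.List.Relation.Unary.AllPairs using ([]; _∷_)
open import Data.List.Relation.Unary.Any as Any using (Any; here; there; any?)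
open import Data.List.Relation.Unary.Unique.Propositional using (Unique)
import Data.List.Relation.Unary.Unique.Propositional.Properties as Unique
open import Data.List.Relation.Unary.Unique.DecPropositional.Properties using (deduplicate-!)
open import Data.Nat as ℕ using (ℕ; zero; suc)
open import Data.Nat.ListAction using (sum)
open import Data.Product using (∃; _×_; _,_; proj₁; proj₂)
open import Data.Nat.Divisibility using (_∣_; divides)
open import Data.Sum using (_⊎_; inj₁; inj₂; [_,_])
open import Function using (_∘_)
open import Induction.WellFounded using (Acc; acc)
open import Relation.Binary.Definitions using (DecidableEquality)
open import Relation.Binary.PropositionalEquality using (_≡_; _≢_; refl; sym; trans; cong; cong₂; subst; module ≡-Reasoning)
open import Relation.Nullary using (Dec; does; yes; no)
open import Relation.Unary using (Pred; Decidable)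
open import Relation.Unary.Properties using (∁?)

module Counting where
  open import Data.Nat using (_+_; _*_; _<_; s≤s; z≤n)
  open import Data.Nat.Properties using (+-suc; *-suc; *-zeroʳ; *-identityˡ; m<n+m)
  open import Data.Nat.Divisibility using (_∣0; ∣m∣n⇒∣m+n; ∣-refl)
  open import Data.Nat.Induction using (<-wellFounded)
  open import Data.Nat.Tactic.RingSolver using (solve-∀)
  open ≡-Reasoning

  -- Defined through does, so that 𝟙 (any? P? (x ∷ xs)) computes as soon as P? x is known.
  𝟙 : ∀ {p} {P : Set p} → Dec P → ℕ
  𝟙 d = if does d then 1 else 0

  𝟙-yes : ∀ {p} {P : Set p} (d : Dec P) → P → 𝟙 d ≡ 1
  𝟙-yes (yes _) _ = refl
  𝟙-yes (no ¬p) p = ⊥-elim (¬p p)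

  𝟙-cong : ∀ {p q} {P : Set p} {Q : Set q} (d : Dec P) (e : Dec Q) → (P → Q) → (Q → P) → 𝟙 d ≡ 𝟙 e
  𝟙-cong (yes _) (yes _) _   _   = refl
  𝟙-cong (no _)  (no _)  _   _   = refl
  𝟙-cong (yes p) (no ¬q) p→q _   = ⊥-elim (¬q (p→q p))
  𝟙-cong (no ¬p) (yes q) _   q→p = ⊥-elim (¬p (q→p q))

  module _ {a} {A : Set a} where

    Σ[_] : List A → (A → ℕ) → ℕ
    Σ[ xs ] f = sum (map f xs)

    Σ-cong : ∀ xs {f g : A → ℕ} → (∀ {x} → x ∈ xs → f x ≡ g x) → Σ[ xs ] f ≡ Σ[ xs ] g
    Σ-cong []       _   = refl
    Σ-cong (x ∷ xs) f≗g = cong₂ _+_ (f≗g (here refl)) (Σ-cong xs (f≗g ∘ there))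

    Σ-distrib-+ : ∀ xs (f g : A → ℕ) → Σ[ xs ] (λ x → f x + g x) ≡ Σ[ xs ] f + Σ[ xs ] g
    Σ-distrib-+ []       f g = refl
    Σ-distrib-+ (x ∷ xs) f g rewrite Σ-distrib-+ xs f g = interchange (f x) (g x) _ _
      where
      interchange : ∀ a b c d → (a + b) + (c + d) ≡ (a + c) + (b + d)
      interchange = solve-∀

    Σ-const : ∀ xs k → Σ[ xs ] (λ _ → k) ≡ k * length xs
    Σ-const []       k = sym (*-zeroʳ k)
    Σ-const (x ∷ xs) k = trans (cong (k +_) (Σ-const xs k)) (sym (*-suc k (length xs)))

    Σ1≡length : ∀ xs → Σ[ xs ] (λ _ → 1) ≡ length xs
    Σ1≡length xs = trans (Σ-const xs 1) (*-identityˡ (length xs))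

    module _ {p} {P : Pred A p} (P? : Decidable P) where

      length-filter≡Σ𝟙 : ∀ xs → length (filter P? xs) ≡ Σ[ xs ] (𝟙 ∘ P?)
      length-filter≡Σ𝟙 []       = refl
      length-filter≡Σ𝟙 (x ∷ xs) with P? x
      ... | yes _ = cong suc (length-filter≡Σ𝟙 xs)
      ... | no  _ = length-filter≡Σ𝟙 xs

      length-filter+length-filter-∁ : ∀ xs → length (filter P? xs) + length (filter (∁? P?) xs) ≡ length xs
      length-filter+length-filter-∁ []       = refl
      length-filter+length-filter-∁ (x ∷ xs) with P? x
      ... | yes _ = cong suc (length-filter+length-filter-∁ xs)
      ... | no  _ = trans (+-suc _ _) (cong suc (length-filter+length-filter-∁ xs))

      Σ𝟙≡𝟙-any : ∀ {xs} → Unique xs → (∀ {x y} → P x → P y → x ≡ y) → Σ[ xs ] (𝟙 ∘ P?) ≡ 𝟙 (any? P? xs)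
      Σ𝟙≡𝟙-any {[]}     _            _      = refl
      Σ𝟙≡𝟙-any {x ∷ xs} (x∉xs ∷ !xs) P-prop with P? x
      ... | no  _  = Σ𝟙≡𝟙-any !xs P-prop
      ... | yes px = cong suc (trans (Σ-cong xs none) (Σ-const xs 0))
        where
        none : ∀ {y} → y ∈ xs → 𝟙 (P? y) ≡ 0
        none {y} y∈xs with P? y
        ... | yes py = ⊥-elim (All.lookup x∉xs y∈xs (P-prop px py))
        ... | no  _  = refl

      Σ𝟙≡1 : ∀ {xs} → Unique xs → (∀ {x y} → P x → P y → x ≡ y) → Any P xs → Σ[ xs ] (𝟙 ∘ P?) ≡ 1
      Σ𝟙≡1 {xs} !xs P-prop any = trans (Σ𝟙≡𝟙-any !xs P-prop) (𝟙-yes (any? P? xs) any)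

  Σ-comm : ∀ {a b} {A : Set a} {B : Set b} xs ys (g : A → B → ℕ) →
           Σ[ xs ] (λ x → Σ[ ys ] (g x)) ≡ Σ[ ys ] (λ y → Σ[ xs ] (λ x → g x y))
  Σ-comm []       ys g = sym (Σ-const ys 0)
  Σ-comm (x ∷ xs) ys g = trans (cong (Σ[ ys ] (g x) +_) (Σ-comm xs ys g))
                               (sym (Σ-distrib-+ ys (g x) (λ y → Σ[ xs ] (λ x′ → g x′ y))))

  module WithDecEq {a} {A : Set a} (_≟_ : DecidableEquality A) where
    open DecMembership _≟_ using (_∈?_)

    unique-triple : ∀ {x y z : A} → x ≢ y → x ≢ z → y ≢ z → Unique (x ∷ y ∷ z ∷ [])
    unique-triple x≢y x≢z y≢z = (x≢y ∷ x≢z ∷ []) ∷ (y≢z ∷ []) ∷ [] ∷ []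

    Σ𝟙-∈ : ∀ {xs ys} → Unique xs → Unique ys → ys ⊆ xs → Σ[ xs ] (λ x → 𝟙 (x ∈? ys)) ≡ length ys
    Σ𝟙-∈ {xs} {ys} !xs !ys ys⊆xs = begin
      Σ[ xs ] (λ x → 𝟙 (x ∈? ys))
        ≡⟨ Σ-cong xs (λ _ → sym (Σ𝟙≡𝟙-any (_ ≟_) !ys (λ p q → trans (sym p) q))) ⟩
      Σ[ xs ] (λ x → Σ[ ys ] (λ y → 𝟙 (x ≟ y)))
        ≡⟨ Σ-comm xs ys _ ⟩
      Σ[ ys ] (λ y → Σ[ xs ] (λ x → 𝟙 (x ≟ y)))
        ≡⟨ Σ-cong ys (λ y∈ys → Σ𝟙≡1 (_≟ _) !xs (λ p q → trans p (sym q)) (Any.map sym (ys⊆xs y∈ys))) ⟩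
      Σ[ ys ] (λ _ → 1)
        ≡⟨ Σ1≡length ys ⟩
      length ys ∎

    length-filter≡length : ∀ {p} {P : Pred A p} (P? : Decidable P) {xs ys} → Unique xs → Unique ys → ys ⊆ xs →
                           (∀ {x} → x ∈ xs → P x → x ∈ ys) → (∀ {x} → x ∈ ys → P x) →
                           length (filter P? xs) ≡ length ys
    length-filter≡length P? {xs} {ys} !xs !ys ys⊆xs P⇒∈ ∈⇒P = begin
      length (filter P? xs)        ≡⟨ length-filter≡Σ𝟙 P? xs ⟩
      Σ[ xs ] (𝟙 ∘ P?)             ≡⟨ Σ-cong xs (λ {x} x∈xs → 𝟙-cong (P? x) (x ∈? ys) (P⇒∈ x∈xs) ∈⇒P) ⟩
      Σ[ xs ] (λ x → 𝟙 (x ∈? ys)) ≡⟨ Σ𝟙-∈ !xs !ys ys⊆xs ⟩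
      length ys                    ∎

    length≡Σ-length-fibres : ∀ {x} {X : Set x} (f : X → A) {D} → Unique D → ∀ xs → (∀ {x} → x ∈ xs → f x ∈ D) →
                             length xs ≡ Σ[ D ] (λ c → length (filter (λ x → f x ≟ c) xs))
    length≡Σ-length-fibres f {D} !D xs f[xs]⊆D = sym (begin
      Σ[ D ] (λ c → length (filter (λ x → f x ≟ c) xs))
        ≡⟨ Σ-cong D (λ {c} _ → length-filter≡Σ𝟙 (λ x → f x ≟ c) xs) ⟩
      Σ[ D ] (λ c → Σ[ xs ] (λ x → 𝟙 (f x ≟ c)))
        ≡⟨ Σ-comm D xs _ ⟩
      Σ[ xs ] (λ x → Σ[ D ] (λ c → 𝟙 (f x ≟ c)))
        ≡⟨ Σ-cong xs (λ x∈xs → Σ𝟙≡1 (_ ≟_) !D (λ p q → trans (sym p) q) (f[xs]⊆D x∈xs)) ⟩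
      Σ[ xs ] (λ _ → 1)
        ≡⟨ Σ1≡length xs ⟩
      length xs ∎)

  module Orbits {a} {A : Set a} (_≟_ : DecidableEquality A) (σ : A → A) where
    open WithDecEq _≟_
    open DecMembership _≟_ using (_∈?_)

    record FreeOrder3Action (L : List A) : Set a where
      field
        closed        : ∀ {x} → x ∈ L → σ x ∈ L
        σ³≡id         : ∀ {x} → x ∈ L → σ (σ (σ x)) ≡ x
        fixpoint-free : ∀ {x} → x ∈ L → σ x ≢ x

    orbit : A → List A
    orbit x = x ∷ σ x ∷ σ (σ x) ∷ []

    module _ {L} (act : FreeOrder3Action L) where
      open FreeOrder3Action act

      orbit⊆ : ∀ {x} → x ∈ L → orbit x ⊆ L
      orbit⊆ x∈L (here refl)                 = x∈L
      orbit⊆ x∈L (there (here refl))         = closed x∈L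
      orbit⊆ x∈L (there (there (here refl))) = closed (closed x∈L)

      σ²-orbit : ∀ {x y} → x ∈ L → y ∈ orbit x → σ (σ y) ∈ orbit x
      σ²-orbit x∈L (here refl)                 = there (there (here refl))
      σ²-orbit x∈L (there (here refl))         = here (σ³≡id x∈L)
      σ²-orbit x∈L (there (there (here refl))) = there (here (cong σ (σ³≡id x∈L)))

      unique-orbit : ∀ {x} → x ∈ L → Unique (orbit x)
      unique-orbit x∈L =
        unique-triple (fixpoint-free x∈L ∘ sym) (λ x≡σ²x → fixpoint-free x∈L (trans (cong σ x≡σ²x) (σ³≡id x∈L)))
                      (fixpoint-free (closed x∈L) ∘ sym)

      length-orbit-filter : ∀ {x} → Unique L → x ∈ L → length (filter (_∈? orbit x) L) ≡ 3
      length-orbit-filter !L x∈L =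
        length-filter≡length (_∈? _) !L (unique-orbit x∈L) (orbit⊆ x∈L) (λ _ y∈O → y∈O) (λ y∈O → y∈O)

      restrict : ∀ {x} → x ∈ L → FreeOrder3Action (filter (∁? (_∈? orbit x)) L)
      restrict {x} x∈L = record
        { closed        = closed′
        ; σ³≡id         = σ³≡id ∘ ⊆L
        ; fixpoint-free = fixpoint-free ∘ ⊆L
        }
        where
        ⊆L : filter (∁? (_∈? orbit x)) L ⊆ L
        ⊆L = proj₁ ∘ ∈-filter⁻ (∁? (_∈? orbit x))
        closed′ : ∀ {y} → y ∈ filter (∁? (_∈? orbit x)) L → σ y ∈ filter (∁? (_∈? orbit x)) L
        closed′ y∈L′ with y∈L , y∉O ← ∈-filter⁻ (∁? (_∈? orbit x)) y∈L′ =
          ∈-filter⁺ (∁? (_∈? orbit x)) (closed y∈L)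
            (λ σy∈O → y∉O (subst (_∈ orbit x) (σ³≡id y∈L) (σ²-orbit x∈L σy∈O)))

    3∣length : ∀ {L} → Unique L → FreeOrder3Action L → 3 ∣ length L
    3∣length {L} = go (<-wellFounded (length L))
      where
      go : ∀ {L} → Acc _<_ (length L) → Unique L → FreeOrder3Action L → 3 ∣ length L
      go {[]}        _        _  _   = 3 ∣0
      go {L@(x ∷ _)} (acc rs) !L act =
        subst (3 ∣_) length-L
          (∣m∣n⇒∣m+n ∣-refl (go (rs length-L′<) (Unique.filter⁺ (∁? (_∈? O)) !L) (restrict act (here refl))))
        where
        O = orbit x
        L′ = filter (∁? (_∈? O)) L
        length-L : 3 + length L′ ≡ length L
        length-L = trans (cong (_+ length L′) (sym (length-orbit-filter act !L (here refl))))
                         (length-filter+length-filter-∁ (_∈? O) L)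
        length-L′< : length L′ < length L
        length-L′< = subst (length L′ <_) length-L (m<n+m (length L′) (s≤s z≤n))

module PowersOfTwo where
  open import Data.Nat using (_+_; _*_; _^_; _%_; _/_)
  open import Data.Nat.DivMod using (m≡m%n+[m/n]*n; [m+kn]%n≡m%n)
  open import Data.Nat.Tactic.RingSolver using (solve-∀)

  4^n≡1+t*3 : ∀ n → ∃ λ t → 2 ^ (n * 2) ≡ 1 + t * 3
  4^n≡1+t*3 zero    = 0 , refl
  4^n≡1+t*3 (suc n) with t , 2^[2n]≡1+3t ← 4^n≡1+t*3 n =
    1 + 4 * t , trans (cong (λ z → 2 * (2 * z)) 2^[2n]≡1+3t) (step t)
    where
    step : ∀ t → 2 * (2 * (1 + t * 3)) ≡ 1 + (1 + 4 * t) * 3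
    step = solve-∀

  2^even≢2+k*3 : ∀ {m} → m % 2 ≡ 0 → ∀ k → 2 ^ m ≢ 2 + k * 3
  2^even≢2+k*3 {m} m-even k 2^m≡2+3k with t , 2^m≡1+3t ← 4^n≡1+t*3 (m / 2) = 1≢2 (begin
    1                  ≡⟨ sym ([m+kn]%n≡m%n 1 t 3) ⟩
    (1 + t * 3) % 3    ≡⟨ cong (_% 3) (trans (sym 2^m≡1+3t) (trans (cong (2 ^_) [m/2]*2≡m) 2^m≡2+3k)) ⟩
    (2 + k * 3) % 3    ≡⟨ [m+kn]%n≡m%n 2 k 3 ⟩
    2                  ∎)
    where
    open ≡-Reasoning
    1≢2 : 1 ≢ 2
    1≢2 ()
    [m/2]*2≡m : m / 2 * 2 ≡ m
    [m/2]*2≡m = sym (trans (m≡m%n+[m/n]*n m 2) (cong (_+ m / 2 * 2) m-even))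

module Char2Field {m} (K : GF2^ m) where
  open Counting
  open GF2^ K
  open IsCommutativeRing isCommutativeRing using (+-assoc; +-comm; +-identityˡ; +-identityʳ; *-assoc; *-comm;
    *-identityˡ; *-identityʳ; zeroˡ; zeroʳ; distribˡ; distribʳ; isCommutativeSemiring)
  open ≡-Reasoning

  commutativeSemiring : CommutativeSemiring 0ℓ 0ℓ
  commutativeSemiring = record { isCommutativeSemiring = isCommutativeSemiring }

  open import Algebra.Solver.Ring.NaturalCoefficients.Default commutativeSemiring using (solve; _:=_; _:+_; _:*_)
  import Algebra.Properties.CommutativeSemiring.Exp commutativeSemiring as Exp

  x+x≡0 : ∀ x → x + x ≡ 0#
  x+x≡0 x = begin
    x + x             ≡⟨ sym (cong₂ _+_ (*-identityʳ x) (*-identityʳ x)) ⟩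
    x * 1# + x * 1#   ≡⟨ sym (distribˡ x 1# 1#) ⟩
    x * (1# + 1#)     ≡⟨ cong (x *_) char2 ⟩
    x * 0#            ≡⟨ zeroʳ x ⟩
    0#                ∎

  x≡y⇒x+y≡0 : ∀ {x y} → x ≡ y → x + y ≡ 0#
  x≡y⇒x+y≡0 {y = y} refl = x+x≡0 y

  x+y≡0⇒x≡y : ∀ {x y} → x + y ≡ 0# → x ≡ y
  x+y≡0⇒x≡y {x} {y} x+y≡0 = begin
    x              ≡⟨ sym (+-identityʳ x) ⟩
    x + 0#         ≡⟨ cong (x +_) (sym (x+x≡0 y)) ⟩
    x + (y + y)    ≡⟨ sym (+-assoc x y y) ⟩
    x + y + y      ≡⟨ cong (_+ y) x+y≡0 ⟩
    0# + y         ≡⟨ +-identityˡ y ⟩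
    y              ∎

  x+y≡x⇒y≡0 : ∀ {x y} → x + y ≡ x → y ≡ 0#
  x+y≡x⇒y≡0 {x} {y} x+y≡x = x+y≡0⇒x≡y (begin
    y + 0#         ≡⟨ cong (y +_) (sym (x+x≡0 x)) ⟩
    y + (x + x)    ≡⟨ solve 2 (λ x y → y :+ (x :+ x) := (x :+ y) :+ x) refl x y ⟩
    (x + y) + x    ≡⟨ x≡y⇒x+y≡0 x+y≡x ⟩
    0#             ∎)

  x*y≡0⇒x≡0⊎y≡0 : ∀ {x y} → x * y ≡ 0# → x ≡ 0# ⊎ y ≡ 0#
  x*y≡0⇒x≡0⊎y≡0 {x} {y} x*y≡0 with x ≟ 0#
  ... | yes x≡0 = inj₁ x≡0
  ... | no  x≢0 = inj₂ (begin
    y                ≡⟨ sym (*-identityˡ y) ⟩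
    1# * y           ≡⟨ cong (_* y) (sym (inverseʳ x x≢0)) ⟩
    x * x ⁻¹ * y     ≡⟨ solve 3 (λ x x⁻¹ y → x :* x⁻¹ :* y := x⁻¹ :* (x :* y)) refl x (x ⁻¹) y ⟩
    x ⁻¹ * (x * y)   ≡⟨ cong (x ⁻¹ *_) x*y≡0 ⟩
    x ⁻¹ * 0#        ≡⟨ zeroʳ _ ⟩
    0#               ∎)

  x*y≢0 : ∀ {x y} → x ≢ 0# → y ≢ 0# → x * y ≢ 0#
  x*y≢0 x≢0 y≢0 x*y≡0 = [ x≢0 , y≢0 ] (x*y≡0⇒x≡0⊎y≡0 x*y≡0)

  *-cancelˡ : ∀ {c x y} → c ≢ 0# → c * x ≡ c * y → x ≡ y
  *-cancelˡ {c} {x} {y} c≢0 cx≡cy =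
    [ ⊥-elim ∘ c≢0 , x+y≡0⇒x≡y ] (x*y≡0⇒x≡0⊎y≡0 (trans (distribˡ c x y) (x≡y⇒x+y≡0 cx≡cy)))

  ^≡Exp^ : ∀ x n → x ^ n ≡ x Exp.^ n
  ^≡Exp^ x zero    = refl
  ^≡Exp^ x (suc n) = cong (x *_) (^≡Exp^ x n)

  ^-distrib-* : ∀ x y n → (x * y) ^ n ≡ x ^ n * y ^ n
  ^-distrib-* x y n = begin
    (x * y) ^ n                ≡⟨ ^≡Exp^ (x * y) n ⟩
    (x * y) Exp.^ n            ≡⟨ Exp.^-distrib-* x y n ⟩
    x Exp.^ n * y Exp.^ n      ≡⟨ sym (cong₂ _*_ (^≡Exp^ x n) (^≡Exp^ y n)) ⟩
    x ^ n * y ^ n              ∎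

  ^-*-assoc : ∀ x a b → x ^ (a ℕ.* b) ≡ (x ^ a) ^ b
  ^-*-assoc x a b = begin
    x ^ (a ℕ.* b)              ≡⟨ ^≡Exp^ x (a ℕ.* b) ⟩
    x Exp.^ (a ℕ.* b)          ≡⟨ sym (Exp.^-assocʳ x a b) ⟩
    (x Exp.^ a) Exp.^ b        ≡⟨ sym (trans (^≡Exp^ (x ^ a) b) (cong (Exp._^ b) (^≡Exp^ x a))) ⟩
    (x ^ a) ^ b                ∎

  x^3≡x*x*x : ∀ x → x ^ 3 ≡ x * (x * x)
  x^3≡x*x*x x = cong (λ z → x * (x * z)) (*-identityʳ x)

  ∑-cong : ∀ n {f g : ℕ → F} → (∀ i → f i ≡ g i) → ∑ n f ≡ ∑ n g
  ∑-cong zero    f≗g = refl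
  ∑-cong (suc n) f≗g = cong₂ _+_ (∑-cong n f≗g) (f≗g n)

  *-distribˡ-∑ : ∀ n c (f : ℕ → F) → c * ∑ n f ≡ ∑ n (λ i → c * f i)
  *-distribˡ-∑ zero    c f = zeroʳ c
  *-distribˡ-∑ (suc n) c f = trans (distribˡ c _ _) (cong (_+ c * f n) (*-distribˡ-∑ n c f))

  [1+x]*y≡y+x*y : ∀ x y → (1# + x) * y ≡ y + x * y
  [1+x]*y≡y+x*y x y = trans (distribʳ y 1# x) (cong (_+ x * y) (*-identityˡ y))

  σ : F → F
  σ x = (1# + x) ⁻¹

  σ-unique : ∀ {x y} → (1# + x) * y ≡ 1# → σ x ≡ y
  σ-unique {x} {y} [1+x]y≡1 = *-cancelˡ 1+x≢0 (trans (inverseʳ (1# + x) 1+x≢0) (sym [1+x]y≡1))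
    where
    1+x≢0 : 1# + x ≢ 0#
    1+x≢0 1+x≡0 = 1≢0 (trans (sym [1+x]y≡1) (trans (cong (_* y) 1+x≡0) (zeroˡ y)))

  module _ {x} (x≢0 : x ≢ 0#) (x≢1 : x ≢ 1#) where

    [1+x]σx≡1 : (1# + x) * σ x ≡ 1#
    [1+x]σx≡1 = inverseʳ (1# + x) (x≢1 ∘ sym ∘ x+y≡0⇒x≡y)

    σx≢0 : σ x ≢ 0#
    σx≢0 σx≡0 = 1≢0 (trans (sym [1+x]σx≡1) (trans (cong ((1# + x) *_) σx≡0) (zeroʳ _)))

    σx≢1 : σ x ≢ 1#
    σx≢1 σx≡1 = x≢0 (x+y≡x⇒y≡0 (trans (sym (*-identityʳ _)) (trans (cong ((1# + x) *_) (sym σx≡1)) [1+x]σx≡1)))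

    xσx≡1+σx : x * σ x ≡ 1# + σ x
    xσx≡1+σx = x+y≡0⇒x≡y (begin
      x * u + (1# + u)    ≡⟨ solve 3 (λ x u o → x :* u :+ (o :+ u) := o :+ (u :+ x :* u)) refl x u 1# ⟩
      1# + (u + x * u)    ≡⟨ cong (1# +_) (sym ([1+x]*y≡y+x*y x u)) ⟩
      1# + (1# + x) * u   ≡⟨ cong (1# +_) [1+x]σx≡1 ⟩
      1# + 1#             ≡⟨ char2 ⟩
      0#                  ∎)
      where u = σ x

    σx≡x⇒x*x+x≡1 : σ x ≡ x → x * x + x ≡ 1#
    σx≡x⇒x*x+x≡1 σx≡x = begin
      x * x + x           ≡⟨ +-comm (x * x) x ⟩
      x + x * x           ≡⟨ sym ([1+x]*y≡y+x*y x x) ⟩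
      (1# + x) * x        ≡⟨ cong ((1# + x) *_) (sym σx≡x) ⟩
      (1# + x) * σ x      ≡⟨ [1+x]σx≡1 ⟩
      1#                  ∎

  σ³≡id : ∀ {x} → x ≢ 0# → x ≢ 1# → σ (σ (σ x)) ≡ x
  σ³≡id {x} x≢0 x≢1 = σ-unique (begin
    (1# + v) * x                ≡⟨ [1+x]*y≡y+x*y v x ⟩
    x + v * x                   ≡⟨ cong (x +_) vx≡1+x ⟩
    x + (1# + x)                ≡⟨ solve 2 (λ x o → x :+ (o :+ x) := o :+ (x :+ x)) refl x 1# ⟩
    1# + (x + x)                ≡⟨ cong (1# +_) (x+x≡0 x) ⟩
    1# + 0#                     ≡⟨ +-identityʳ 1# ⟩
    1#                          ∎)
    where
    u = σ x
    v = σ u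
    vx≡1+x : v * x ≡ 1# + x
    vx≡1+x = begin
      v * x                       ≡⟨ sym (*-identityʳ _) ⟩
      v * x * 1#                  ≡⟨ cong (v * x *_) (sym ([1+x]σx≡1 x≢0 x≢1)) ⟩
      v * x * ((1# + x) * u)      ≡⟨ solve 4 (λ v x u s → v :* x :* (s :* u) := (x :* u) :* v :* s) refl v x u (1# + x) ⟩
      x * u * v * (1# + x)        ≡⟨ cong (λ z → z * v * (1# + x)) (xσx≡1+σx x≢0 x≢1) ⟩
      (1# + u) * v * (1# + x)     ≡⟨ cong (_* (1# + x)) ([1+x]σx≡1 (σx≢0 x≢0 x≢1) (σx≢1 x≢0 x≢1)) ⟩
      1# * (1# + x)               ≡⟨ *-identityˡ _ ⟩
      1# + x                      ∎

  open DecMembership _≟_ using (_∈?_)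
  open WithDecEq _≟_ using (unique-triple; length-filter≡length; length≡Σ-length-fibres)
  open Orbits _≟_ σ using (FreeOrder3Action; 3∣length)

  0,1 : List F
  0,1 = 0# ∷ 1# ∷ []

  F∖0,1 : List F
  F∖0,1 = filter (∁? (_∈? 0,1)) elems

  length-elems≡2+length-F∖0,1 : length elems ≡ 2 ℕ.+ length F∖0,1
  length-elems≡2+length-F∖0,1 = begin
    length elems                                      ≡⟨ sym (length-filter+length-filter-∁ (_∈? 0,1) elems) ⟩
    length (filter (_∈? 0,1) elems) ℕ.+ length F∖0,1  ≡⟨ cong (ℕ._+ length F∖0,1) length-0,1 ⟩
    2 ℕ.+ length F∖0,1                                ∎
    where
    length-0,1 : length (filter (_∈? 0,1) elems) ≡ 2
    length-0,1 =
      length-filter≡length (_∈? 0,1) unique ((1≢0 ∘ sym ∷ []) ∷ [] ∷ []) (λ _ → complete _) (λ _ p → p) (λ p → p)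

  3∣length-F∖0,1 : (∀ x → x * x + x ≢ 1#) → 3 ∣ length F∖0,1
  3∣length-F∖0,1 ∄ω = 3∣length (Unique.filter⁺ (∁? (_∈? 0,1)) unique) (record
    { closed        = λ x∈L → let x≢0 , x≢1 = ≢0,1 x∈L in ∈-filter⁺ (∁? (_∈? 0,1)) (complete _)
                        λ { (here σx≡0) → σx≢0 x≢0 x≢1 σx≡0 ; (there (here σx≡1)) → σx≢1 x≢0 x≢1 σx≡1 }
    ; σ³≡id         = λ x∈L → let x≢0 , x≢1 = ≢0,1 x∈L in σ³≡id x≢0 x≢1
    ; fixpoint-free = λ {x} x∈L σx≡x → let x≢0 , x≢1 = ≢0,1 x∈L in ∄ω x (σx≡x⇒x*x+x≡1 x≢0 x≢1 σx≡x)
    })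
    where
    ≢0,1 : ∀ {x} → x ∈ F∖0,1 → x ≢ 0# × x ≢ 1#
    ≢0,1 x∈L with _ , x∉0,1 ← ∈-filter⁻ (∁? (_∈? 0,1)) {xs = elems} x∈L = x∉0,1 ∘ here , x∉0,1 ∘ there ∘ here

  ∃x*x+x≡1 : m ℕ.% 2 ≡ 0 → ∃ λ ω → ω * ω + ω ≡ 1#
  ∃x*x+x≡1 m-even with any? (λ x → (x * x + x) ≟ 1#) elems
  ... | yes ∃ω = Any.satisfied ∃ω
  ... | no  ∄ω with divides k length≡k*3 ← 3∣length-F∖0,1 (λ x → ∄ω ∘ lose (complete x)) =
    ⊥-elim (PowersOfTwo.2^even≢2+k*3 {m} m-even k
             (trans (sym card) (trans length-elems≡2+length-F∖0,1 (cong (2 ℕ.+_) length≡k*3))))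

  module PrimitiveCubeRoot (ω : F) (ω*ω+ω≡1 : ω * ω + ω ≡ 1#) where

    ω≢0 : ω ≢ 0#
    ω≢0 refl = 1≢0 (trans (sym ω*ω+ω≡1) (trans (+-identityʳ _) (zeroˡ 0#)))

    ω≢1 : ω ≢ 1#
    ω≢1 refl = 1≢0 (trans (sym ω*ω+ω≡1) (trans (cong (_+ 1#) (*-identityˡ 1#)) char2))

    ω*ω≡1+ω : ω * ω ≡ 1# + ω
    ω*ω≡1+ω = x+y≡0⇒x≡y (begin
      ω * ω + (1# + ω)  ≡⟨ solve 3 (λ ω o ω² → ω² :+ (o :+ ω) := (ω² :+ ω) :+ o) refl ω 1# (ω * ω) ⟩
      (ω * ω + ω) + 1#  ≡⟨ cong (_+ 1#) ω*ω+ω≡1 ⟩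
      1# + 1#           ≡⟨ char2 ⟩
      0#                ∎)

    ω*ω≢1 : ω * ω ≢ 1#
    ω*ω≢1 ω*ω≡1 = ω≢0 (x+y≡x⇒y≡0 (trans (sym ω*ω≡1+ω) ω*ω≡1))

    ω*[ω*ω]≡1 : ω * (ω * ω) ≡ 1#
    ω*[ω*ω]≡1 = begin
      ω * (ω * ω)    ≡⟨ cong (ω *_) ω*ω≡1+ω ⟩
      ω * (1# + ω)   ≡⟨ solve 2 (λ ω o → ω :* (o :+ ω) := ω :* ω :+ ω :* o) refl ω 1# ⟩
      ω * ω + ω * 1# ≡⟨ cong (ω * ω +_) (*-identityʳ ω) ⟩
      ω * ω + ω      ≡⟨ ω*ω+ω≡1 ⟩
      1#             ∎

    ω^4^i≡ω : ∀ i → ω ^ (4 ℕ.^ i) ≡ ω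
    ω^4^i≡ω zero    = *-identityʳ ω
    ω^4^i≡ω (suc i) = begin
      ω ^ (4 ℕ.* 4 ℕ.^ i)  ≡⟨ ^-*-assoc ω 4 (4 ℕ.^ i) ⟩
      (ω ^ 4) ^ 4 ℕ.^ i    ≡⟨ cong (_^ 4 ℕ.^ i) ω^4≡ω ⟩
      ω ^ 4 ℕ.^ i          ≡⟨ ω^4^i≡ω i ⟩
      ω                    ∎
      where
      ω^4≡ω : ω ^ 4 ≡ ω
      ω^4≡ω = trans (cong (ω *_) (trans (x^3≡x*x*x ω) ω*[ω*ω]≡1)) (*-identityʳ ω)

    cubeRoots : F → List F
    cubeRoots b = b ∷ ω * b ∷ ω * (ω * b) ∷ []

    [y+b][y+ωb][y+ω²b]≡y³+b³ : ∀ y b → (y + b) * ((y + ω * b) * (y + ω * (ω * b))) ≡ y ^ 3 + b ^ 3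
    [y+b][y+ωb][y+ω²b]≡y³+b³ y b = begin
      (y + b) * ((y + ω * b) * (y + ω * (ω * b)))
        ≡⟨ solve 3 (λ y b ω → (y :+ b) :* ((y :+ ω :* b) :* (y :+ ω :* (ω :* b))) :=
                     y :* (y :* y) :+ ω :* (ω :* ω) :* (b :* (b :* b))
                     :+ ((ω :* ω :+ ω) :* (y :* y :* b :+ ω :* (y :* (b :* b)))
                         :+ (y :* y :* b :+ ω :* (y :* (b :* b)))))
                   refl y b ω ⟩
      y * (y * y) + ω * (ω * ω) * (b * (b * b)) + ((ω * ω + ω) * t + t)
        ≡⟨ cong₂ (λ c d → y * (y * y) + c * (b * (b * b)) + (d * t + t)) ω*[ω*ω]≡1 ω*ω+ω≡1 ⟩
      y * (y * y) + 1# * (b * (b * b)) + (1# * t + t)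
        ≡⟨ cong₂ (λ c d → y * (y * y) + c + (d + t)) (*-identityˡ _) (*-identityˡ t) ⟩
      y * (y * y) + b * (b * b) + (t + t)
        ≡⟨ cong₂ _+_ (sym (cong₂ _+_ (x^3≡x*x*x y) (x^3≡x*x*x b))) (x+x≡0 t) ⟩
      y ^ 3 + b ^ 3 + 0#
        ≡⟨ +-identityʳ _ ⟩
      y ^ 3 + b ^ 3 ∎
      where t = y * y * b + ω * (y * (b * b))

    cube-roots : ∀ {y b} → y ^ 3 ≡ b ^ 3 → y ∈ cubeRoots b
    cube-roots {y} {b} y³≡b³
      with x*y≡0⇒x≡0⊎y≡0 (trans ([y+b][y+ωb][y+ω²b]≡y³+b³ y b) (x≡y⇒x+y≡0 y³≡b³))
    ... | inj₁ y+b≡0 = here (x+y≡0⇒x≡y y+b≡0)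
    ... | inj₂ rest with x*y≡0⇒x≡0⊎y≡0 rest
    ...   | inj₁ y+ωb≡0  = there (here (x+y≡0⇒x≡y y+ωb≡0))
    ...   | inj₂ y+ω²b≡0 = there (there (here (x+y≡0⇒x≡y y+ω²b≡0)))

    unique-cubeRoots : ∀ {b} → b ≢ 0# → Unique (cubeRoots b)
    unique-cubeRoots {b} b≢0 = unique-triple b≢ωb b≢ω²b (b≢ωb ∘ *-cancelˡ ω≢0)
      where
      b≢ωb : b ≢ ω * b
      b≢ωb b≡ωb = ω≢1 (sym (*-cancelˡ b≢0 (trans (*-identityʳ b) (trans b≡ωb (*-comm ω b)))))
      b≢ω²b : b ≢ ω * (ω * b)
      b≢ω²b b≡ω²b = ω*ω≢1 (sym (*-cancelˡ b≢0
        (trans (*-identityʳ b) (trans b≡ω²b (trans (sym (*-assoc ω ω b)) (*-comm (ω * ω) b))))))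

    [ωb]^3≡b^3 : ∀ b → (ω * b) ^ 3 ≡ b ^ 3
    [ωb]^3≡b^3 b = trans (^-distrib-* ω b 3) (trans (cong (_* b ^ 3) (trans (x^3≡x*x*x ω) ω*[ω*ω]≡1)) (*-identityˡ _))

    Tr₂[ωb]≡ωTr₂b : ∀ b → Tr₂ (ω * b) ≡ ω * Tr₂ b
    Tr₂[ωb]≡ωTr₂b b =
      trans (∑-cong (m ℕ./ 2) ωb^4^i≡ωb^4^i) (sym (*-distribˡ-∑ (m ℕ./ 2) ω (λ i → b ^ (4 ℕ.^ i))))
      where
      ωb^4^i≡ωb^4^i : ∀ i → (ω * b) ^ (4 ℕ.^ i) ≡ ω * b ^ (4 ℕ.^ i)
      ωb^4^i≡ωb^4^i i = trans (^-distrib-* ω b (4 ℕ.^ i)) (cong (_* b ^ (4 ℕ.^ i)) (ω^4^i≡ω i))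

    InF4*-ω* : ∀ {β} → InF4* β → InF4* (ω * β)
    InF4*-ω* {β} (β^4≡β , β≢0) = trans (^-distrib-* ω β 4) (cong₂ _*_ (ω^4^i≡ω 1) β^4≡β) , x*y≢0 ω≢0 β≢0

    InS-ω* : ∀ {β ε b} → InS β ε b → InS (ω * β) ε (ω * b)
    InS-ω* {b = b} (b≢0 , Tr[b³]≡ε , Tr₂b≡β) =
      x*y≢0 ω≢0 b≢0 , trans (cong Tr ([ωb]^3≡b^3 b)) Tr[b³]≡ε , trans (Tr₂[ωb]≡ωTr₂b b) (cong (ω *_) Tr₂b≡β)

    module _ (ε : Bool) where

      ω*-Union : ∀ {b} → b ∈ Union ε → ω * b ∈ Union ε
      ω*-Union b∈U with β , β∈F4* , b∈Sβ ← find (proj₂ (∈-filter⁻ (InUnion? ε) {xs = elems} b∈U)) =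
        ∈-filter⁺ (InUnion? ε) (complete _)
          (lose (∈-filter⁺ InF4*? (complete _) (InF4*-ω* (proj₂ (∈-filter⁻ InF4*? {xs = elems} β∈F4*))))
                (InS-ω* {ε = ε} b∈Sβ))

      length-cube-fibre : ∀ {c} → c ∈ Cubes ε → length (filter (λ x → (x ^ 3) ≟ c) (Union ε)) ≡ 3
      length-cube-fibre {c} c∈Cubes with b , b∈U , c≡b³ ← ∈-map⁻ (_^ 3) (∈-deduplicate⁻ _≟_ _ c∈Cubes) =
        length-filter≡length (λ x → (x ^ 3) ≟ c) !U (unique-cubeRoots b≢0) roots⊆U
          (λ _ x³≡c → cube-roots (trans x³≡c c≡b³)) (λ x∈roots → trans (root³≡b³ x∈roots) (sym c≡b³))
        where
        !U : Unique (Union ε)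
        !U = Unique.filter⁺ (InUnion? ε) unique
        b≢0 : b ≢ 0#
        b≢0 = proj₁ (proj₂ (Any.satisfied (proj₂ (∈-filter⁻ (InUnion? ε) {xs = elems} b∈U))))
        roots⊆U : cubeRoots b ⊆ Union ε
        roots⊆U (here refl)                 = b∈U
        roots⊆U (there (here refl))         = ω*-Union b∈U
        roots⊆U (there (there (here refl))) = ω*-Union (ω*-Union b∈U)
        root³≡b³ : ∀ {x} → x ∈ cubeRoots b → x ^ 3 ≡ b ^ 3
        root³≡b³ (here refl)                 = refl
        root³≡b³ (there (here refl))         = [ωb]^3≡b^3 b
        root³≡b³ (there (there (here refl))) = trans ([ωb]^3≡b^3 (ω * b)) ([ωb]^3≡b^3 b)

      length-Union≡3*length-Cubes : length (Union ε) ≡ 3 ℕ.* length (Cubes ε)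
      length-Union≡3*length-Cubes = begin
        length (Union ε)
          ≡⟨ length≡Σ-length-fibres (_^ 3) (deduplicate-! _≟_ _) (Union ε) (∈-deduplicate⁺ _≟_ ∘ ∈-map⁺ (_^ 3)) ⟩
        Σ[ Cubes ε ] (λ c → length (filter (λ x → (x ^ 3) ≟ c) (Union ε)))
          ≡⟨ Σ-cong (Cubes ε) length-cube-fibre ⟩
        Σ[ Cubes ε ] (λ _ → 3)
          ≡⟨ Σ-const (Cubes ε) 3 ⟩
        3 ℕ.* length (Cubes ε) ∎

  Σ-length-S≡length-Union : ∀ ε → Σ[ F4* ] (λ β → length (S β ε)) ≡ length (Union ε)
  Σ-length-S≡length-Union ε = begin
    Σ[ F4* ] (λ β → length (S β ε))
      ≡⟨ Σ-cong F4* (λ {β} _ → length-filter≡Σ𝟙 (InS? β ε) elems) ⟩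
    Σ[ F4* ] (λ β → Σ[ elems ] (𝟙 ∘ InS? β ε))
      ≡⟨ Σ-comm F4* elems _ ⟩
    Σ[ elems ] (λ b → Σ[ F4* ] (λ β → 𝟙 (InS? β ε b)))
      ≡⟨ Σ-cong elems (λ {b} _ → Σ𝟙≡𝟙-any (λ β → InS? β ε b) !F4* Tr₂-determines) ⟩
    Σ[ elems ] (𝟙 ∘ InUnion? ε)
      ≡⟨ sym (length-filter≡Σ𝟙 (InUnion? ε) elems) ⟩
    length (Union ε) ∎
    where
    !F4* : Unique F4*
    !F4* = Unique.filter⁺ InF4*? unique
    Tr₂-determines : ∀ {b β β′} → InS β ε b → InS β′ ε b → β ≡ β′
    Tr₂-determines (_ , _ , Tr₂b≡β) (_ , _ , Tr₂b≡β′) = trans (sym Tr₂b≡β) Tr₂b≡β′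

-- Imported only here: the field operations opened above share the names of ℕ's.
open import Data.Nat using (_*_; _>_; _%_)

-- The hypothesis m > 2 is only needed for the residue of K(a) modulo 24, not for this count.
lemma15 : (m : ℕ) → m > 2 → m % 2 ≡ 0 → (K : GF2^ m) → (ε : Bool) →
          3 * length (GF2^.Cubes K ε) ≡ sum (map (λ β → length (GF2^.S K β ε)) (GF2^.F4* K))
lemma15 m _ m-even K ε with ω , ω*ω+ω≡1 ← Char2Field.∃x*x+x≡1 K m-even =
  sym (trans (Char2Field.Σ-length-S≡length-Union K ε)
             (Char2Field.PrimitiveCubeRoot.length-Union≡3*length-Cubes K ω ω*ω+ω≡1 ε))
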